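{- Let $m$ and $n$ be positive integers with $n \geq 4$ even, let $0 \leq \ell \leq n-1$ be an integer of the same parity as $m$, and let $$G = \langle t,x,y \mid t^2,\ x^{n/2},\ y^m = x^{(\ell + m)/2},\ txt = x^{ -1},\ tyt = y^{ -1},\ xy = yx\rangle.$$ Then there exists a group automorphism $\varphi$ of $G$ with $\varphi(tx)=tx$, $\varphi(t)=ty$ and $\varphi(ty)=t$ if and only if $\gcd(n,\ell-m) = 2m$ and $2mn \mid (\ell^2-2m\ell-3m^2)$. -}

module Defs where

open import Level using (0ℓ)
open import Data.Nat using (ℕ; zero; suc; _+_; _*_; _/_)
open import Data.Fin using (Fin)
import Data.Fin as Fin
open import Data.Product using (_,_)
open import Algebra.Bundles using (Group)

data Term (X : Set) : Set where
  gen  : X → Term X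
  e    : Term X
  _·_  : Term X → Term X → Term X
  inv  : Term X → Term X

infixl 7 _·_

record Presentation : Set₁ where
  field
    Gens : Set
    Rels : Set
    lhs  : Rels → Term Gens
    rhs  : Rels → Term Gens

module _ (P : Presentation) where
  open Presentation P

  data _≈ᴾ_ : Term Gens → Term Gens → Set where
    ≈-refl  : ∀ {a} → a ≈ᴾ a
    ≈-sym   : ∀ {a b} → a ≈ᴾ b → b ≈ᴾ a
    ≈-trans : ∀ {a b c} → a ≈ᴾ b → b ≈ᴾ c → a ≈ᴾ c
    ·-cong  : ∀ {a b c d} → a ≈ᴾ b → c ≈ᴾ d → (a · c) ≈ᴾ (b · d)
    inv-cong : ∀ {a b} → a ≈ᴾ b → inv a ≈ᴾ inv b
    assoc   : ∀ a b c → ((a · b) · c) ≈ᴾ (a · (b · c))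
    idˡ     : ∀ a → (e · a) ≈ᴾ a
    idʳ     : ∀ a → (a · e) ≈ᴾ a
    invˡ    : ∀ a → (inv a · a) ≈ᴾ e
    invʳ    : ∀ a → (a · inv a) ≈ᴾ e
    rel     : ∀ r → lhs r ≈ᴾ rhs r

  PresentedGroup : Group 0ℓ 0ℓ
  PresentedGroup = record
    { Carrier = Term Gens
    ; _≈_ = _≈ᴾ_
    ; _∙_ = _·_
    ; ε = e
    ; _⁻¹ = inv
    ; isGroup = record
      { isMonoid = record
        { isSemigroup = record
          { isMagma = record
            { isEquivalence = record { refl = ≈-refl ; sym = ≈-sym ; trans = ≈-trans }
            ; ∙-cong = ·-cong }
          ; assoc = assoc }
        ; identity = idˡ , idʳ }
      ; inverse = invˡ , invʳ
      ; ⁻¹-cong = inv-cong } }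

_^_ : ∀ {X} → Term X → ℕ → Term X
a ^ zero  = e
a ^ suc k = a · (a ^ k)

T X Y : Term (Fin 3)
T = gen Fin.zero
X = gen (Fin.suc Fin.zero)
Y = gen (Fin.suc (Fin.suc Fin.zero))

Gpres : ℕ → ℕ → ℕ → Presentation
Gpres m n ℓ = record
  { Gens = Fin 3 ; Rels = Fin 6 ; lhs = L ; rhs = R }
  where
  L R : Fin 6 → Term (Fin 3)
  L Fin.zero = T ^ 2
  L (Fin.suc Fin.zero) = X ^ (n / 2)
  L (Fin.suc (Fin.suc Fin.zero)) = Y ^ m
  L (Fin.suc (Fin.suc (Fin.suc Fin.zero))) = T · X · T
  L (Fin.suc (Fin.suc (Fin.suc (Fin.suc Fin.zero)))) = T · Y · T
  L (Fin.suc (Fin.suc (Fin.suc (Fin.suc (Fin.suc Fin.zero))))) = X · Y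
  R Fin.zero = e
  R (Fin.suc Fin.zero) = e
  R (Fin.suc (Fin.suc Fin.zero)) = X ^ ((ℓ + m) / 2)
  R (Fin.suc (Fin.suc (Fin.suc Fin.zero))) = inv X
  R (Fin.suc (Fin.suc (Fin.suc (Fin.suc Fin.zero)))) = inv Y
  R (Fin.suc (Fin.suc (Fin.suc (Fin.suc (Fin.suc Fin.zero))))) = Y · X

G : ℕ → ℕ → ℕ → Group 0ℓ 0ℓ
G m n ℓ = PresentedGroup (Gpres m n ℓ)

module Submission where

-- Write h = n/2 and k = (ℓ+m)/2.  An automorphism φ as required is forced on the generators:
-- φ x = φ t · φ (t x) = y⁻¹ x and φ y = φ t · φ (t y) = y⁻¹.  Conversely t ↦ t y, x ↦ x y⁻¹,
-- y ↦ y⁻¹ is an involution on words that respects every defining relation except possibly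
-- x^h = 1 and y^m = x^k, and on those it amounts to y^h = 1 and y^k = y^(2m).  To decide these
-- we model G as ℤ/2 ⋉ ℤ²/Λ, where Λ is spanned by the relator exponents (h, 0) and (k, −m):
-- both relations hold iff h = p m and k = q m with p ∣ q (q − 2).  As n = 2 p m, ℓ − m = 2 m (q − 1),
-- 2 m n = 4 m² p and ℓ² − 2mℓ − 3m² = 4 m² q (q − 2), and (q − 1)² − q (q − 2) = 1, this is exactly
-- gcd (n, ℓ − m) = 2 m together with 2 m n ∣ ℓ² − 2mℓ − 3m².

open import Defs
open import Data.Nat as ℕ using (ℕ; _<_; _≤_)
open import Data.Nat.Divisibility as ℕD using ()
open import Data.Integer as ℤ using (ℤ; +_; _-_; _*_)
open import Data.Integer.Divisibility as ℤD using ()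
open import Data.Integer.GCD as ℤG using ()
open import Data.Product using (Σ; _×_)
open import Function.Bundles using (_⇔_; mk⇔)
open import Relation.Binary.PropositionalEquality using (_≡_)
open import Algebra.Bundles using (Group)
open import Algebra.Morphism.Structures using (module GroupMorphisms)

open import Data.Nat using (zero; suc)
open import Data.Fin using (Fin)
import Data.Fin as Fin
open import Data.Integer using (_+_; -_; -[1+_])
import Data.Integer.Properties as ℤP
import Data.Integer.Divisibility.Signed as ℤS
open import Data.Integer.Tactic.RingSolver using (solve-∀)
import Data.Nat.Tactic.RingSolver as ℕSolver
import Data.Nat.Properties as ℕP
import Data.Nat.DivMod as ℕDM
open import Function.Construct.Composition using (_⇔-∘_)
open import Data.Product using (_,_)
open import Data.Bool using (Bool; true; false; _xor_)
open import Data.Bool.Properties using (xor-assoc; xor-same)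
open import Level using (0ℓ)
open import Relation.Binary.PropositionalEquality as ≡ using (refl; _≢_)
import Relation.Binary.Reasoning.Setoid as SetoidReasoning
import Algebra.Properties.Monoid.Mult as MonoidMult
import Algebra.Properties.Group as GroupProperties
import Algebra.Solver.Monoid as MonoidSolver

i-j≡r*h⇒i≡j+r*h : ∀ i j r h → + i - + j ≡ + r * + h → i ≡ j ℕ.+ r ℕ.* h
i-j≡r*h⇒i≡j+r*h i j r h eq = ℤP.+-injective (begin
  + i                  ≡⟨ shift (+ i) (+ j) ⟩
  + j + (+ i - + j)    ≡⟨ ≡.cong (λ z → + j + z) eq ⟩
  + j + + r * + h      ≡⟨ ≡.cong (λ z → + j + z) (ℤP.pos-* r h) ⟨
  + j + + (r ℕ.* h)    ≡⟨ ℤP.pos-+ j (r ℕ.* h) ⟨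
  + (j ℕ.+ r ℕ.* h)    ∎)
  where
  open ≡.≡-Reasoning
  shift : ∀ a b → a ≡ b + (a - b)
  shift = solve-∀

gcd-bezout : ∀ {i j d} a b → + d ℤS.∣ i → + d ℤS.∣ j → a * i + b * j ≡ + d → ℤG.gcd i j ≡ + d
gcd-bezout {i} {j} {d} a b d∣i d∣j a*i+b*j≡d = ≡.cong +_ (ℕD.∣-antisym gcd∣d d∣gcd)
  where
  gcd∣d : ℤG.gcd i j ℤD.∣ + d
  gcd∣d = ℤS.∣⇒∣ᵤ (≡.subst (ℤG.gcd i j ℤS.∣_) a*i+b*j≡d
    (ℤS.∣m∣n⇒∣m+n (ℤS.∣n⇒∣m*n a (ℤS.∣ᵤ⇒∣ (ℤG.gcd[i,j]∣i i j)))
                  (ℤS.∣n⇒∣m*n b (ℤS.∣ᵤ⇒∣ (ℤG.gcd[i,j]∣j i j)))))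
  d∣gcd : + d ℤD.∣ ℤG.gcd i j
  d∣gcd = ℤG.gcd-greatest {i} {j} {+ d} (ℤS.∣⇒∣ᵤ d∣i) (ℤS.∣⇒∣ᵤ d∣j)

+-quotient : ∀ {h m} .{{_ : ℕ.NonZero m}} {P} → + h ≡ P * + m → Σ ℕ λ p → (h ≡ p ℕ.* m) × (P ≡ + p)
+-quotient {h} {m} {P} h≡P*m = p , h≡p*m , ℤP.*-cancelʳ-≡ P (+ p) (+ m) (begin
    P * + m     ≡⟨ h≡P*m ⟨
    + h         ≡⟨ ≡.cong +_ h≡p*m ⟩
    + (p ℕ.* m) ≡⟨ ℤP.pos-* p m ⟩
    + p * + m   ∎)
  where
  open ≡.≡-Reasoning
  m∣h : m ℕD.∣ h
  m∣h = ℤS.∣⇒∣ᵤ (ℤS.divides P h≡P*m)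
  p : ℕ
  p = ℕD.quotient m∣h
  h≡p*m : h ≡ p ℕ.* m
  h≡p*m = ℕD.m∣n⇒n≡quotient*m m∣h

module Presented (P : Presentation) where

  open Presentation P

  private
    𝔾 = PresentedGroup P
    module Mult = MonoidMult (Group.monoid 𝔾)

  infix 4 _≈_
  _≈_ : Term Gens → Term Gens → Set
  _≈_ = _≈ᴾ_ P

  open SetoidReasoning (Group.setoid 𝔾) public
  open MonoidSolver (Group.monoid 𝔾) public using (solve; _⊕_; _⊜_; id)
  open GroupProperties 𝔾 public using (⁻¹-involutive; ⁻¹-anti-homo-∙; ε⁻¹≈ε)

  ≡⇒≈ : ∀ {a b} → a ≡ b → a ≈ b
  ≡⇒≈ refl = ≈-refl

  Commute : Term Gens → Term Gens → Set
  Commute a b = a · b ≈ b · a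

  ^≡× : ∀ a i → a ^ i ≡ i Mult.× a
  ^≡× a zero    = refl
  ^≡× a (suc i) = ≡.cong (a ·_) (^≡× a i)

  ^-+ : ∀ a i j → a ^ (i ℕ.+ j) ≈ a ^ i · a ^ j
  ^-+ a i j rewrite ^≡× a (i ℕ.+ j) | ^≡× a i | ^≡× a j = Mult.×-homo-+ a i j

  ^-* : ∀ a i j → (a ^ i) ^ j ≈ a ^ (j ℕ.* i)
  ^-* a i j rewrite ^≡× (a ^ i) j | ^≡× a i | ^≡× a (j ℕ.* i) = Mult.×-assocˡ a j i

  ^-cong : ∀ {a b} i → a ≈ b → a ^ i ≈ b ^ i
  ^-cong {a} {b} i a≈b rewrite ^≡× a i | ^≡× b i = Mult.×-congʳ i a≈b

  e^ : ∀ i → e ^ i ≈ e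
  e^ zero    = ≈-refl
  e^ (suc i) = ≈-trans (idˡ _) (e^ i)

  ^-comm : ∀ {a b} i → Commute a b → Commute (a ^ i) b
  ^-comm zero    ab≈ba = ≈-trans (idˡ _) (≈-sym (idʳ _))
  ^-comm {a} {b} (suc i) ab≈ba = begin
    (a · a ^ i) · b ≈⟨ assoc _ _ _ ⟩
    a · (a ^ i · b) ≈⟨ ·-cong ≈-refl (^-comm i ab≈ba) ⟩
    a · (b · a ^ i) ≈⟨ ≈-sym (assoc _ _ _) ⟩
    (a · b) · a ^ i ≈⟨ ·-cong ab≈ba ≈-refl ⟩
    (b · a) · a ^ i ≈⟨ assoc _ _ _ ⟩
    b · (a · a ^ i) ∎

  ^-distrib-· : ∀ {a b} i → Commute a b → (a · b) ^ i ≈ a ^ i · b ^ i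
  ^-distrib-· zero    ab≈ba = ≈-sym (idˡ _)
  ^-distrib-· {a} {b} (suc i) ab≈ba = begin
    (a · b) · (a · b) ^ i     ≈⟨ ·-cong ≈-refl (^-distrib-· i ab≈ba) ⟩
    (a · b) · (a ^ i · b ^ i) ≈⟨ assoc _ _ _ ⟩
    a · (b · (a ^ i · b ^ i)) ≈⟨ ·-cong ≈-refl (≈-sym (assoc _ _ _)) ⟩
    a · ((b · a ^ i) · b ^ i) ≈⟨ ·-cong ≈-refl (·-cong (≈-sym (^-comm i ab≈ba)) ≈-refl) ⟩
    a · ((a ^ i · b) · b ^ i) ≈⟨ ·-cong ≈-refl (assoc _ _ _) ⟩
    a · (a ^ i · (b · b ^ i)) ≈⟨ ≈-sym (assoc _ _ _) ⟩
    (a · a ^ i) · (b · b ^ i) ∎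

  commute-inv : ∀ {a b} → Commute a b → Commute a (inv b)
  commute-inv {a} {b} ab≈ba = begin
    a · inv b                     ≈⟨ ≈-sym (idˡ _) ⟩
    e · (a · inv b)               ≈⟨ ·-cong (≈-sym (invˡ b)) ≈-refl ⟩
    (inv b · b) · (a · inv b)     ≈⟨ reassoc (inv b) b a ⟩
    inv b · ((b · a) · inv b)     ≈⟨ ·-cong ≈-refl (·-cong (≈-sym ab≈ba) ≈-refl) ⟩
    inv b · ((a · b) · inv b)     ≈⟨ ·-cong ≈-refl (assoc _ _ _) ⟩
    inv b · (a · (b · inv b))     ≈⟨ ·-cong ≈-refl (·-cong ≈-refl (invʳ b)) ⟩
    inv b · (a · e)               ≈⟨ ·-cong ≈-refl (idʳ a) ⟩
    inv b · a                     ∎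
    where
    reassoc : ∀ x y z → (x · y) · (z · x) ≈ x · ((y · z) · x)
    reassoc x y z = solve 3 (λ x y z → (x ⊕ y) ⊕ (z ⊕ x) ⊜ x ⊕ ((y ⊕ z) ⊕ x)) ≈-refl x y z

  inv^ : ∀ a i → inv a ^ i ≈ inv (a ^ i)
  inv^ a zero    = ≈-sym ε⁻¹≈ε
  inv^ a (suc i) = begin
    inv a · inv a ^ i     ≈⟨ ·-cong ≈-refl (inv^ a i) ⟩
    inv a · inv (a ^ i)   ≈⟨ ≈-sym (⁻¹-anti-homo-∙ (a ^ i) a) ⟩
    inv (a ^ i · a)       ≈⟨ inv-cong (^-comm i ≈-refl) ⟩
    inv (a · a ^ i)       ∎

  ^-absorb : ∀ {a h} → a ^ h ≈ e → ∀ i r → a ^ (i ℕ.+ r ℕ.* h) ≈ a ^ i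
  ^-absorb {a} {h} a^h≈e i r = begin
    a ^ (i ℕ.+ r ℕ.* h)       ≈⟨ ^-+ a i (r ℕ.* h) ⟩
    a ^ i · a ^ (r ℕ.* h)     ≈⟨ ·-cong ≈-refl (≈-sym (^-* a h r)) ⟩
    a ^ i · (a ^ h) ^ r       ≈⟨ ·-cong ≈-refl (^-cong r a^h≈e) ⟩
    a ^ i · e ^ r             ≈⟨ ·-cong ≈-refl (e^ r) ⟩
    a ^ i · e                 ≈⟨ idʳ _ ⟩
    a ^ i                     ∎

  ^-periodic : ∀ {a h} → a ^ h ≈ e → ∀ {i j} → + h ℤS.∣ + i - + j → a ^ i ≈ a ^ j
  ^-periodic {a} {h} a^h≈e {i} {j} (ℤS.divides (+ r) eq) = begin
    a ^ i               ≡⟨ ≡.cong (a ^_) (i-j≡r*h⇒i≡j+r*h i j r h eq) ⟩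
    a ^ (j ℕ.+ r ℕ.* h) ≈⟨ ^-absorb a^h≈e j r ⟩
    a ^ j               ∎
  ^-periodic {a} {h} a^h≈e {i} {j} (ℤS.divides -[1+ r ] eq) = begin
    a ^ i                     ≈⟨ ≈-sym (^-absorb a^h≈e i (suc r)) ⟩
    a ^ (i ℕ.+ suc r ℕ.* h)   ≡⟨ ≡.cong (a ^_) (i-j≡r*h⇒i≡j+r*h j i (suc r) h j-i≡) ⟨
    a ^ j                     ∎
    where
    swap : ∀ a b → b - a ≡ - (a - b)
    swap = solve-∀
    j-i≡ : + j - + i ≡ + suc r * + h
    j-i≡ = ≡.trans (swap (+ i) (+ j))
             (≡.trans (≡.cong -_ eq) (ℤP.neg-distribˡ-* -[1+ r ] (+ h)))

  module _ {ψ} (ψ-homo : GroupMorphisms.IsGroupHomomorphism (Group.rawGroup 𝔾) (Group.rawGroup 𝔾) ψ) where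

    open GroupMorphisms.IsGroupHomomorphism ψ-homo

    homo-^ : ∀ a i → ψ (a ^ i) ≈ ψ a ^ i
    homo-^ a zero    = ε-homo
    homo-^ a (suc i) = ≈-trans (homo a (a ^ i)) (·-cong ≈-refl (homo-^ a i))

module Evaluation (P : Presentation) {c ℓ} (H : Group c ℓ) (ρ : Presentation.Gens P → Group.Carrier H) where

  open Presentation P
  private
    module H = Group H

  eval : Term Gens → H.Carrier
  eval (gen g) = ρ g
  eval e       = H.ε
  eval (a · b) = eval a H.∙ eval b
  eval (inv a) = eval a H.⁻¹

  module _ (eval-rel : ∀ r → eval (lhs r) H.≈ eval (rhs r)) where

    eval-cong : ∀ {a b} → _≈ᴾ_ P a b → eval a H.≈ eval b
    eval-cong ≈-refl          = H.refl
    eval-cong (≈-sym p)       = H.sym (eval-cong p)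
    eval-cong (≈-trans p q)   = H.trans (eval-cong p) (eval-cong q)
    eval-cong (·-cong p q)    = H.∙-cong (eval-cong p) (eval-cong q)
    eval-cong (inv-cong p)    = H.⁻¹-cong (eval-cong p)
    eval-cong (assoc a b c)   = H.assoc _ _ _
    eval-cong (idˡ a)         = H.identityˡ _
    eval-cong (idʳ a)         = H.identityʳ _
    eval-cong (invˡ a)        = H.inverseˡ _
    eval-cong (invʳ a)        = H.inverseʳ _
    eval-cong (rel r)         = eval-rel r

    eval-isGroupHomomorphism :
      GroupMorphisms.IsGroupHomomorphism (Group.rawGroup (PresentedGroup P)) H.rawGroup eval
    eval-isGroupHomomorphism = record
      { isMonoidHomomorphism = record
        { isMagmaHomomorphism = record
          { isRelHomomorphism = record { cong = eval-cong }
          ; homo = λ _ _ → H.refl }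
        ; ε-homo = H.refl }
      ; ⁻¹-homo = λ _ → H.refl }

module Substitution (P : Presentation) (ρ : Presentation.Gens P → Term (Presentation.Gens P)) where

  open Presentation P
  open Presented P using (_≈_)
  open Evaluation P (PresentedGroup P) ρ public

  eval-^ : ∀ a i → eval (a ^ i) ≡ eval a ^ i
  eval-^ a zero    = refl
  eval-^ a (suc i) = ≡.cong (eval a ·_) (eval-^ a i)

  eval-involutive : (∀ g → eval (ρ g) ≈ gen g) → ∀ a → eval (eval a) ≈ a
  eval-involutive ρ² (gen g) = ρ² g
  eval-involutive ρ² e       = ≈-refl
  eval-involutive ρ² (a · b) = ·-cong (eval-involutive ρ² a) (eval-involutive ρ² b)
  eval-involutive ρ² (inv a) = inv-cong (eval-involutive ρ² a)

  involution⇒isGroupIsomorphism :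
    (eval-rel : ∀ r → eval (lhs r) ≈ eval (rhs r)) → (∀ g → eval (ρ g) ≈ gen g) →
    GroupMorphisms.IsGroupIsomorphism (Group.rawGroup (PresentedGroup P)) (Group.rawGroup (PresentedGroup P)) eval
  involution⇒isGroupIsomorphism eval-rel ρ² = record
    { isGroupMonomorphism = record
      { isGroupHomomorphism = eval-isGroupHomomorphism eval-rel
      ; injective = λ {a} {b} p →
          ≈-trans (≈-sym (eval-involutive ρ² a)) (≈-trans (eval-cong eval-rel p) (eval-involutive ρ² b)) }
    ; surjective = λ a → eval a , λ b≈ → ≈-trans (eval-cong eval-rel b≈) (eval-involutive ρ² a) }

-- ⟨ s , a , b ⟩ stands for x^a y^b t^s; Λ is the lattice of exponents (a, b) with x^a y^b = 1.
module Semidirect (h k m : ℤ) where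

  Λ : ℤ → ℤ → Set
  Λ a b = Σ ℤ λ i → Σ ℤ λ j → (a ≡ i * h + j * k) × (b ≡ - (j * m))

  Λ-resp : ∀ {a a′ b b′} → a ≡ a′ → b ≡ b′ → Λ a b → Λ a′ b′
  Λ-resp refl refl λab = λab

  Λ-0 : Λ (+ 0) (+ 0)
  Λ-0 = + 0 , + 0 , lin (+ 0) (+ 0) , neg (+ 0)
    where
    lin : ∀ h k → + 0 ≡ + 0 * h + + 0 * k
    lin = solve-∀
    neg : ∀ m → + 0 ≡ - (+ 0 * m)
    neg = solve-∀

  Λ-+ : ∀ {a b a′ b′} → Λ a b → Λ a′ b′ → Λ (a + a′) (b + b′)
  Λ-+ (i , j , refl , refl) (i′ , j′ , refl , refl) = i + i′ , j + j′ , lin i j i′ j′ h k , neg j j′ m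
    where
    lin : ∀ i j i′ j′ h k → (i * h + j * k) + (i′ * h + j′ * k) ≡ (i + i′) * h + (j + j′) * k
    lin = solve-∀
    neg : ∀ j j′ m → - (j * m) + - (j′ * m) ≡ - ((j + j′) * m)
    neg = solve-∀

  Λ-neg : ∀ {a b} → Λ a b → Λ (- a) (- b)
  Λ-neg (i , j , refl , refl) = - i , - j , lin i j h k , neg j m
    where
    lin : ∀ i j h k → - (i * h + j * k) ≡ (- i) * h + (- j) * k
    lin = solve-∀
    neg : ∀ j m → - - (j * m) ≡ - ((- j) * m)
    neg = solve-∀

  σ : Bool → ℤ → ℤ
  σ false a = a
  σ true  a = - a

  σ-xor : ∀ s t a → σ (s xor t) a ≡ σ s (σ t a)
  σ-xor false t     a = refl
  σ-xor true  false a = refl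
  σ-xor true  true  a = ≡.sym (ℤP.neg-involutive a)

  σ-+ : ∀ s a b → σ s (a + b) ≡ σ s a + σ s b
  σ-+ false a b = refl
  σ-+ true  a b = ℤP.neg-distrib-+ a b

  σ-neg : ∀ s a → σ s (- a) ≡ - σ s a
  σ-neg false a = refl
  σ-neg true  a = refl

  σ-involutive : ∀ s a → σ s (σ s a) ≡ a
  σ-involutive false a = refl
  σ-involutive true  a = ℤP.neg-involutive a

  Λ-σ : ∀ s {a b} → Λ a b → Λ (σ s a) (σ s b)
  Λ-σ false λab = λab
  Λ-σ true  λab = Λ-neg λab

  record Elt : Set where
    constructor ⟨_,_,_⟩
    field
      flip : Bool
      a b  : ℤ

  infixl 7 _∙_
  infix 8 _⁻¹

  _∙_ : Elt → Elt → Elt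
  ⟨ s , a , b ⟩ ∙ ⟨ s′ , a′ , b′ ⟩ = ⟨ s xor s′ , a + σ s a′ , b + σ s b′ ⟩

  _⁻¹ : Elt → Elt
  ⟨ s , a , b ⟩ ⁻¹ = ⟨ s , - σ s a , - σ s b ⟩

  ε : Elt
  ε = ⟨ false , + 0 , + 0 ⟩

  infix 4 _∼_
  record _∼_ (u v : Elt) : Set where
    constructor mk∼
    field
      flip-≡ : Elt.flip u ≡ Elt.flip v
      Λ-diff : Λ (Elt.a u - Elt.a v) (Elt.b u - Elt.b v)

  ∼-refl : ∀ {u} → u ∼ u
  ∼-refl {⟨ s , a , b ⟩} = mk∼ refl (Λ-resp (≡.sym (ℤP.+-inverseʳ a)) (≡.sym (ℤP.+-inverseʳ b)) Λ-0)

  ≡⇒∼ : ∀ {s s′ a a′ b b′} → s ≡ s′ → a ≡ a′ → b ≡ b′ → ⟨ s , a , b ⟩ ∼ ⟨ s′ , a′ , b′ ⟩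
  ≡⇒∼ refl refl refl = ∼-refl

  ∼-sym : ∀ {u v} → u ∼ v → v ∼ u
  ∼-sym {⟨ s , a , b ⟩} {⟨ s′ , a′ , b′ ⟩} (mk∼ p λab) =
    mk∼ (≡.sym p) (Λ-resp (swap a a′) (swap b b′) (Λ-neg λab))
    where
    swap : ∀ a a′ → - (a - a′) ≡ a′ - a
    swap = solve-∀

  ∼-trans : ∀ {u v w} → u ∼ v → v ∼ w → u ∼ w
  ∼-trans {⟨ s , a , b ⟩} {⟨ s′ , a′ , b′ ⟩} {⟨ s″ , a″ , b″ ⟩} (mk∼ p λ₁) (mk∼ q λ₂) =
    mk∼ (≡.trans p q) (Λ-resp (telescope a a′ a″) (telescope b b′ b″) (Λ-+ λ₁ λ₂))
    where
    telescope : ∀ a a′ a″ → (a - a′) + (a′ - a″) ≡ a - a″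
    telescope = solve-∀

  ∙-cong : ∀ {u u′ v v′} → u ∼ u′ → v ∼ v′ → u ∙ v ∼ u′ ∙ v′
  ∙-cong {⟨ s , a , b ⟩} {⟨ .s , a′ , b′ ⟩} {⟨ t , c , d ⟩} {⟨ .t , c′ , d′ ⟩} (mk∼ refl λ₁) (mk∼ refl λ₂) =
    mk∼ refl (Λ-resp (regroup s a a′ c c′) (regroup s b b′ d d′) (Λ-+ λ₁ (Λ-σ s λ₂)))
    where
    regroup : ∀ s a a′ c c′ → (a - a′) + σ s (c - c′) ≡ (a + σ s c) - (a′ + σ s c′)
    regroup false = plus
      where
      plus : ∀ a a′ c c′ → (a - a′) + (c - c′) ≡ (a + c) - (a′ + c′)
      plus = solve-∀
    regroup true  = minus
      where
      minus : ∀ a a′ c c′ → (a - a′) + - (c - c′) ≡ (a + - c) - (a′ + - c′)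
      minus = solve-∀

  ⁻¹-cong : ∀ {u u′} → u ∼ u′ → u ⁻¹ ∼ u′ ⁻¹
  ⁻¹-cong {⟨ s , a , b ⟩} {⟨ .s , a′ , b′ ⟩} (mk∼ refl λab) =
    mk∼ refl (Λ-resp (regroup s a a′) (regroup s b b′) (Λ-neg (Λ-σ s λab)))
    where
    regroup : ∀ s a a′ → - σ s (a - a′) ≡ - σ s a - - σ s a′
    regroup false = plus
      where
      plus : ∀ a a′ → - (a - a′) ≡ - a - - a′
      plus = solve-∀
    regroup true  = minus
      where
      minus : ∀ a a′ → - - (a - a′) ≡ - - a - - - a′
      minus = solve-∀

  ∙-assoc : ∀ u v w → (u ∙ v) ∙ w ∼ u ∙ (v ∙ w)
  ∙-assoc ⟨ s , a , b ⟩ ⟨ t , c , d ⟩ ⟨ u , f , g ⟩ =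
    ≡⇒∼ (xor-assoc s t u) (twisted-assoc a c f) (twisted-assoc b d g)
    where
    twisted-assoc : ∀ a c f → (a + σ s c) + σ (s xor t) f ≡ a + σ s (c + σ t f)
    twisted-assoc a c f = begin
      (a + σ s c) + σ (s xor t) f   ≡⟨ ≡.cong (λ z → (a + σ s c) + z) (σ-xor s t f) ⟩
      (a + σ s c) + σ s (σ t f)     ≡⟨ ℤP.+-assoc a _ _ ⟩
      a + (σ s c + σ s (σ t f))     ≡⟨ ≡.cong (λ z → a + z) (σ-+ s c (σ t f)) ⟨
      a + σ s (c + σ t f)           ∎
      where open ≡.≡-Reasoning

  ∙-identityˡ : ∀ u → ε ∙ u ∼ u
  ∙-identityˡ ⟨ s , a , b ⟩ = ≡⇒∼ refl (ℤP.+-identityˡ a) (ℤP.+-identityˡ b)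

  ∙-identityʳ : ∀ u → u ∙ ε ∼ u
  ∙-identityʳ ⟨ false , a , b ⟩ = ≡⇒∼ refl (ℤP.+-identityʳ a) (ℤP.+-identityʳ b)
  ∙-identityʳ ⟨ true  , a , b ⟩ = ≡⇒∼ refl (ℤP.+-identityʳ a) (ℤP.+-identityʳ b)

  ∙-inverseˡ : ∀ u → u ⁻¹ ∙ u ∼ ε
  ∙-inverseˡ ⟨ s , a , b ⟩ = ≡⇒∼ (xor-same s) (ℤP.+-inverseˡ (σ s a)) (ℤP.+-inverseˡ (σ s b))

  ∙-inverseʳ : ∀ u → u ∙ u ⁻¹ ∼ ε
  ∙-inverseʳ ⟨ s , a , b ⟩ = ≡⇒∼ (xor-same s) (cancel a) (cancel b)
    where
    cancel : ∀ a → a + σ s (- σ s a) ≡ + 0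
    cancel a = begin
      a + σ s (- σ s a)   ≡⟨ ≡.cong (λ z → a + z) (σ-neg s (σ s a)) ⟩
      a + - σ s (σ s a)   ≡⟨ ≡.cong (λ z → a + - z) (σ-involutive s a) ⟩
      a + - a             ≡⟨ ℤP.+-inverseʳ a ⟩
      + 0                 ∎
      where open ≡.≡-Reasoning

  group : Group 0ℓ 0ℓ
  group = record
    { Carrier = Elt
    ; _≈_ = _∼_
    ; _∙_ = _∙_
    ; ε = ε
    ; _⁻¹ = _⁻¹
    ; isGroup = record
      { isMonoid = record
        { isSemigroup = record
          { isMagma = record
            { isEquivalence = record { refl = ∼-refl ; sym = ∼-sym ; trans = ∼-trans }
            ; ∙-cong = ∙-cong }
          ; assoc = ∙-assoc }
        ; identity = ∙-identityˡ , ∙-identityʳ }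
      ; inverse = ∙-inverseˡ , ∙-inverseʳ
      ; ⁻¹-cong = ⁻¹-cong } }

  ∼-reflexive : ∀ {u v} → u ≡ v → u ∼ v
  ∼-reflexive refl = ∼-refl

record Factorisation (m h k : ℕ) : Set where
  constructor factorisation
  field
    p q       : ℕ
    c         : ℤ
    h≡p*m     : h ≡ p ℕ.* m
    k≡q*m     : k ≡ q ℕ.* m
    q²-2q≡c*p : + q * + q - + 2 * + q ≡ c * + p

  +h≡p*m : + h ≡ + p * + m
  +h≡p*m = ≡.trans (≡.cong +_ h≡p*m) (ℤP.pos-* p m)

  +k≡q*m : + k ≡ + q * + m
  +k≡q*m = ≡.trans (≡.cong +_ k≡q*m) (ℤP.pos-* q m)

  p*k≡q*h : p ℕ.* k ≡ q ℕ.* h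
  p*k≡q*h rewrite h≡p*m | k≡q*m = commute p q m
    where
    commute : ∀ p q m → p ℕ.* (q ℕ.* m) ≡ q ℕ.* (p ℕ.* m)
    commute = ℕSolver.solve-∀

  h∣q*k-2k : + h ℤS.∣ + (q ℕ.* k) - + (k ℕ.+ k)
  h∣q*k-2k = ℤS.divides c (begin
    + (q ℕ.* k) - + (k ℕ.+ k)       ≡⟨ ≡.cong₂ _-_ (ℤP.pos-* q k) (ℤP.pos-+ k k) ⟩
    Q * K - (K + K)                 ≡⟨ ≡.cong (λ z → Q * z - (z + z)) +k≡q*m ⟩
    Q * (Q * M) - (Q * M + Q * M)   ≡⟨ factor Q M ⟩
    (Q * Q - + 2 * Q) * M           ≡⟨ ≡.cong (_* M) q²-2q≡c*p ⟩
    c * P * M                       ≡⟨ ℤP.*-assoc c P M ⟩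
    c * (P * M)                     ≡⟨ ≡.cong (c *_) +h≡p*m ⟨
    c * H                           ∎)
    where
    open ≡.≡-Reasoning
    P Q M H K : ℤ
    P = + p
    Q = + q
    M = + m
    H = + h
    K = + k
    factor : ∀ q m → q * (q * m) - (q * m + q * m) ≡ (q * q - + 2 * q) * m
    factor = solve-∀

module TwistedGroup (m n ℓ : ℕ) where

  open Presented (Gpres m n ℓ) public

  h k : ℕ
  h = n ℕ./ 2
  k = (ℓ ℕ.+ m) ℕ./ 2

  t²≈e : T · T ≈ e
  t²≈e = ≈-trans (·-cong ≈-refl (≈-sym (idʳ T))) (rel Fin.zero)

  x^h≈e : X ^ h ≈ e
  x^h≈e = rel (Fin.suc Fin.zero)

  y^m≈x^k : Y ^ m ≈ X ^ k
  y^m≈x^k = rel (Fin.suc (Fin.suc Fin.zero))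

  txt≈x⁻¹ : T · X · T ≈ inv X
  txt≈x⁻¹ = rel (Fin.suc (Fin.suc (Fin.suc Fin.zero)))

  tyt≈y⁻¹ : T · Y · T ≈ inv Y
  tyt≈y⁻¹ = rel (Fin.suc (Fin.suc (Fin.suc (Fin.suc Fin.zero))))

  xy≈yx : Commute X Y
  xy≈yx = rel (Fin.suc (Fin.suc (Fin.suc (Fin.suc (Fin.suc Fin.zero)))))

  t[ta]≈a : ∀ a → T · (T · a) ≈ a
  t[ta]≈a a = ≈-trans (≈-sym (assoc _ _ _)) (≈-trans (·-cong t²≈e ≈-refl) (idˡ a))

  y^[j*m]≈x^[j*k] : ∀ j → Y ^ (j ℕ.* m) ≈ X ^ (j ℕ.* k)
  y^[j*m]≈x^[j*k] j = begin
    Y ^ (j ℕ.* m) ≈⟨ ≈-sym (^-* Y m j) ⟩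
    (Y ^ m) ^ j   ≈⟨ ^-cong j y^m≈x^k ⟩
    (X ^ k) ^ j   ≈⟨ ^-* X k j ⟩
    X ^ (j ℕ.* k) ∎

  -- The images of x^h = 1 and y^m = x^k under the twist, simplified using the other relations.
  YRelations : Set
  YRelations = (Y ^ h ≈ e) × (Y ^ k ≈ Y ^ m · Y ^ m)

  Twist : Set
  Twist = Σ (Group.Carrier (G m n ℓ) → Group.Carrier (G m n ℓ)) λ φ →
      GroupMorphisms.IsGroupIsomorphism (Group.rawGroup (G m n ℓ)) (Group.rawGroup (G m n ℓ)) φ
    × Group._≈_ (G m n ℓ) (φ (T · X)) (T · X)
    × Group._≈_ (G m n ℓ) (φ T) (T · Y)
    × Group._≈_ (G m n ℓ) (φ (T · Y)) T

  x·y⁻¹≈y⁻¹·x : Commute X (inv Y)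
  x·y⁻¹≈y⁻¹·x = commute-inv xy≈yx

  twist : Fin 3 → Term (Fin 3)
  twist Fin.zero                     = T · Y
  twist (Fin.suc Fin.zero)           = X · inv Y
  twist (Fin.suc (Fin.suc Fin.zero)) = inv Y

  module Twist = Substitution (Gpres m n ℓ) twist

  twist-involutive : ∀ g → Twist.eval (twist g) ≈ gen g
  twist-involutive Fin.zero = begin
    (T · Y) · inv Y ≈⟨ assoc _ _ _ ⟩
    T · (Y · inv Y) ≈⟨ ·-cong ≈-refl (invʳ Y) ⟩
    T · e           ≈⟨ idʳ T ⟩
    T               ∎
  twist-involutive (Fin.suc Fin.zero) = begin
    (X · inv Y) · inv (inv Y) ≈⟨ assoc _ _ _ ⟩
    X · (inv Y · inv (inv Y)) ≈⟨ ·-cong ≈-refl (invʳ (inv Y)) ⟩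
    X · e                     ≈⟨ idʳ X ⟩
    X                         ∎
  twist-involutive (Fin.suc (Fin.suc Fin.zero)) = ⁻¹-involutive Y

  twist-t² : (T · Y) · ((T · Y) · e) ≈ e
  twist-t² = begin
    (T · Y) · ((T · Y) · e) ≈⟨ solve 2 (λ t y → (t ⊕ y) ⊕ ((t ⊕ y) ⊕ id) ⊜ ((t ⊕ y) ⊕ t) ⊕ y) ≈-refl T Y ⟩
    ((T · Y) · T) · Y       ≈⟨ ·-cong tyt≈y⁻¹ ≈-refl ⟩
    inv Y · Y               ≈⟨ invˡ Y ⟩
    e                       ∎

  twist-x^h : Y ^ h ≈ e → (X · inv Y) ^ h ≈ e
  twist-x^h y^h≈e = begin
    (X · inv Y) ^ h     ≈⟨ ^-distrib-· h x·y⁻¹≈y⁻¹·x ⟩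
    X ^ h · inv Y ^ h   ≈⟨ ·-cong x^h≈e (inv^ Y h) ⟩
    e · inv (Y ^ h)     ≈⟨ idˡ _ ⟩
    inv (Y ^ h)         ≈⟨ inv-cong y^h≈e ⟩
    inv e               ≈⟨ ε⁻¹≈ε ⟩
    e                   ∎

  twist-y^m : Y ^ k ≈ Y ^ m · Y ^ m → inv Y ^ m ≈ (X · inv Y) ^ k
  twist-y^m y^k≈y^m·y^m = ≈-sym (begin
    (X · inv Y) ^ k                      ≈⟨ ^-distrib-· k x·y⁻¹≈y⁻¹·x ⟩
    X ^ k · inv Y ^ k                    ≈⟨ ·-cong (≈-sym y^m≈x^k) (inv^ Y k) ⟩
    Y ^ m · inv (Y ^ k)                  ≈⟨ ·-cong ≈-refl (inv-cong y^k≈y^m·y^m) ⟩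
    Y ^ m · inv (Y ^ m · Y ^ m)          ≈⟨ ·-cong ≈-refl (⁻¹-anti-homo-∙ _ _) ⟩
    Y ^ m · (inv (Y ^ m) · inv (Y ^ m))  ≈⟨ ≈-sym (assoc _ _ _) ⟩
    (Y ^ m · inv (Y ^ m)) · inv (Y ^ m)  ≈⟨ ·-cong (invʳ _) ≈-refl ⟩
    e · inv (Y ^ m)                      ≈⟨ idˡ _ ⟩
    inv (Y ^ m)                          ≈⟨ ≈-sym (inv^ Y m) ⟩
    inv Y ^ m                            ∎)

  twist-txt : ((T · Y) · (X · inv Y)) · (T · Y) ≈ inv (X · inv Y)
  twist-txt = begin
    ((T · Y) · (X · inv Y)) · (T · Y) ≈⟨ ·-cong (·-cong ≈-refl x·y⁻¹≈y⁻¹·x) ≈-refl ⟩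
    ((T · Y) · (inv Y · X)) · (T · Y) ≈⟨ solve 4 (λ t y z x → ((t ⊕ y) ⊕ (z ⊕ x)) ⊕ (t ⊕ y) ⊜ t ⊕ ((y ⊕ z) ⊕ ((x ⊕ t) ⊕ y))) ≈-refl T Y (inv Y) X ⟩
    T · ((Y · inv Y) · ((X · T) · Y)) ≈⟨ ·-cong ≈-refl (·-cong (invʳ Y) ≈-refl) ⟩
    T · (e · ((X · T) · Y))           ≈⟨ solve 3 (λ t x y → t ⊕ (id ⊕ ((x ⊕ t) ⊕ y)) ⊜ ((t ⊕ x) ⊕ t) ⊕ y) ≈-refl T X Y ⟩
    ((T · X) · T) · Y                 ≈⟨ ·-cong txt≈x⁻¹ ≈-refl ⟩
    inv X · Y                         ≈⟨ ≈-sym (commute-inv (≈-sym xy≈yx)) ⟩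
    Y · inv X                         ≈⟨ ·-cong (≈-sym (⁻¹-involutive Y)) ≈-refl ⟩
    inv (inv Y) · inv X               ≈⟨ ≈-sym (⁻¹-anti-homo-∙ X (inv Y)) ⟩
    inv (X · inv Y)                   ∎

  twist-tyt : ((T · Y) · inv Y) · (T · Y) ≈ inv (inv Y)
  twist-tyt = begin
    ((T · Y) · inv Y) · (T · Y) ≈⟨ ·-cong (twist-involutive Fin.zero) ≈-refl ⟩
    T · (T · Y)                 ≈⟨ t[ta]≈a Y ⟩
    Y                           ≈⟨ ≈-sym (⁻¹-involutive Y) ⟩
    inv (inv Y)                 ∎

  twist-xy : Commute (X · inv Y) (inv Y)
  twist-xy = begin
    (X · inv Y) · inv Y ≈⟨ ·-cong x·y⁻¹≈y⁻¹·x ≈-refl ⟩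
    (inv Y · X) · inv Y ≈⟨ assoc _ _ _ ⟩
    inv Y · (X · inv Y) ∎

  YRelations⇒Twist : YRelations → Twist
  YRelations⇒Twist (y^h≈e , y^k≈y^m·y^m) =
      Twist.eval
    , Twist.involution⇒isGroupIsomorphism twist-rel twist-involutive
    , twist-tx , ≈-refl , twist-involutive Fin.zero
    where
    twist-rel : ∀ r → Twist.eval (Presentation.lhs (Gpres m n ℓ) r) ≈ Twist.eval (Presentation.rhs (Gpres m n ℓ) r)
    twist-rel Fin.zero = twist-t²
    twist-rel (Fin.suc Fin.zero) = ≈-trans (≡⇒≈ (Twist.eval-^ X h)) (twist-x^h y^h≈e)
    twist-rel (Fin.suc (Fin.suc Fin.zero)) =
      ≈-trans (≡⇒≈ (Twist.eval-^ Y m)) (≈-trans (twist-y^m y^k≈y^m·y^m) (≡⇒≈ (≡.sym (Twist.eval-^ X k))))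
    twist-rel (Fin.suc (Fin.suc (Fin.suc Fin.zero))) = twist-txt
    twist-rel (Fin.suc (Fin.suc (Fin.suc (Fin.suc Fin.zero)))) = twist-tyt
    twist-rel (Fin.suc (Fin.suc (Fin.suc (Fin.suc (Fin.suc Fin.zero))))) = twist-xy
    twist-tx : (T · Y) · (X · inv Y) ≈ T · X
    twist-tx = begin
      (T · Y) · (X · inv Y) ≈⟨ ·-cong ≈-refl x·y⁻¹≈y⁻¹·x ⟩
      (T · Y) · (inv Y · X) ≈⟨ solve 4 (λ t y z x → (t ⊕ y) ⊕ (z ⊕ x) ⊜ t ⊕ ((y ⊕ z) ⊕ x)) ≈-refl T Y (inv Y) X ⟩
      T · ((Y · inv Y) · X) ≈⟨ ·-cong ≈-refl (·-cong (invʳ Y) ≈-refl) ⟩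
      T · (e · X)           ≈⟨ ·-cong ≈-refl (idˡ X) ⟩
      T · X                 ∎

  module TwistingEndomorphism {ψ : Term (Fin 3) → Term (Fin 3)}
    (ψ-hom : GroupMorphisms.IsGroupHomomorphism (Group.rawGroup (G m n ℓ)) (Group.rawGroup (G m n ℓ)) ψ)
    (ψ[tx] : ψ (T · X) ≈ T · X) (ψ[t] : ψ T ≈ T · Y) (ψ[ty] : ψ (T · Y) ≈ T) where

    open GroupMorphisms.IsGroupHomomorphism ψ-hom using (⟦⟧-cong; homo; ε-homo)

    ψ[x] : ψ X ≈ inv Y · X
    ψ[x] = begin
      ψ X                 ≈⟨ ⟦⟧-cong (≈-sym (t[ta]≈a X)) ⟩
      ψ (T · (T · X))     ≈⟨ homo T (T · X) ⟩
      ψ T · ψ (T · X)     ≈⟨ ·-cong ψ[t] ψ[tx] ⟩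
      (T · Y) · (T · X)   ≈⟨ ≈-sym (assoc _ _ _) ⟩
      ((T · Y) · T) · X   ≈⟨ ·-cong tyt≈y⁻¹ ≈-refl ⟩
      inv Y · X           ∎

    ψ[y] : ψ Y ≈ inv Y
    ψ[y] = begin
      ψ Y                 ≈⟨ ⟦⟧-cong (≈-sym (t[ta]≈a Y)) ⟩
      ψ (T · (T · Y))     ≈⟨ homo T (T · Y) ⟩
      ψ T · ψ (T · Y)     ≈⟨ ·-cong ψ[t] ψ[ty] ⟩
      (T · Y) · T         ≈⟨ tyt≈y⁻¹ ⟩
      inv Y               ∎

    ψ[x]^ : ∀ i → ψ (X ^ i) ≈ inv (Y ^ i) · X ^ i
    ψ[x]^ i = begin
      ψ (X ^ i)           ≈⟨ homo-^ ψ-hom X i ⟩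
      ψ X ^ i             ≈⟨ ^-cong i ψ[x] ⟩
      (inv Y · X) ^ i     ≈⟨ ^-distrib-· i (≈-sym x·y⁻¹≈y⁻¹·x) ⟩
      inv Y ^ i · X ^ i   ≈⟨ ·-cong (inv^ Y i) ≈-refl ⟩
      inv (Y ^ i) · X ^ i ∎

    y^h≈e : Y ^ h ≈ e
    y^h≈e = begin
      Y ^ h                   ≈⟨ ≈-sym (⁻¹-involutive _) ⟩
      inv (inv (Y ^ h))       ≈⟨ inv-cong (≈-sym (idʳ _)) ⟩
      inv (inv (Y ^ h) · e)   ≈⟨ inv-cong (·-cong ≈-refl (≈-sym x^h≈e)) ⟩
      inv (inv (Y ^ h) · X ^ h) ≈⟨ inv-cong (≈-sym (ψ[x]^ h)) ⟩
      inv (ψ (X ^ h))         ≈⟨ inv-cong (⟦⟧-cong x^h≈e) ⟩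
      inv (ψ e)               ≈⟨ inv-cong ε-homo ⟩
      inv e                   ≈⟨ ε⁻¹≈ε ⟩
      e                       ∎

    y^m⁻¹≈y^k⁻¹·y^m : inv (Y ^ m) ≈ inv (Y ^ k) · Y ^ m
    y^m⁻¹≈y^k⁻¹·y^m = begin
      inv (Y ^ m)             ≈⟨ ≈-sym (inv^ Y m) ⟩
      inv Y ^ m               ≈⟨ ^-cong m (≈-sym ψ[y]) ⟩
      ψ Y ^ m                 ≈⟨ ≈-sym (homo-^ ψ-hom Y m) ⟩
      ψ (Y ^ m)               ≈⟨ ⟦⟧-cong y^m≈x^k ⟩
      ψ (X ^ k)               ≈⟨ ψ[x]^ k ⟩
      inv (Y ^ k) · X ^ k     ≈⟨ ·-cong ≈-refl (≈-sym y^m≈x^k) ⟩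
      inv (Y ^ k) · Y ^ m     ∎

    y^k≈y^m·y^m : Y ^ k ≈ Y ^ m · Y ^ m
    y^k≈y^m·y^m = begin
      Y ^ k                               ≈⟨ ≈-sym (idʳ _) ⟩
      Y ^ k · e                           ≈⟨ ·-cong ≈-refl (≈-sym (invˡ (Y ^ m))) ⟩
      Y ^ k · (inv (Y ^ m) · Y ^ m)       ≈⟨ ·-cong ≈-refl (·-cong y^m⁻¹≈y^k⁻¹·y^m ≈-refl) ⟩
      Y ^ k · ((inv (Y ^ k) · Y ^ m) · Y ^ m) ≈⟨ solve 3 (λ a b c → a ⊕ ((b ⊕ c) ⊕ c) ⊜ (a ⊕ b) ⊕ (c ⊕ c)) ≈-refl (Y ^ k) (inv (Y ^ k)) (Y ^ m) ⟩
      (Y ^ k · inv (Y ^ k)) · (Y ^ m · Y ^ m) ≈⟨ ·-cong (invʳ _) ≈-refl ⟩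
      e · (Y ^ m · Y ^ m)                 ≈⟨ idˡ _ ⟩
      Y ^ m · Y ^ m                       ∎

  Twist⇒YRelations : Twist → YRelations
  Twist⇒YRelations (ψ , ψ-iso , ψ[tx] , ψ[t] , ψ[ty]) = y^h≈e , y^k≈y^m·y^m
    where
    open GroupMorphisms.IsGroupIsomorphism ψ-iso using (isGroupHomomorphism)
    open TwistingEndomorphism isGroupHomomorphism ψ[tx] ψ[t] ψ[ty]

  Factorisation⇒YRelations : Factorisation m h k → YRelations
  Factorisation⇒YRelations f = y^h≈e , y^k≈y^m·y^m
    where
    open Factorisation f
    y^h≈e : Y ^ h ≈ e
    y^h≈e = begin
      Y ^ h           ≡⟨ ≡.cong (Y ^_) h≡p*m ⟩
      Y ^ (p ℕ.* m)   ≈⟨ y^[j*m]≈x^[j*k] p ⟩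
      X ^ (p ℕ.* k)   ≡⟨ ≡.cong (X ^_) p*k≡q*h ⟩
      X ^ (q ℕ.* h)   ≈⟨ ^-absorb x^h≈e 0 q ⟩
      e               ∎

    y^k≈y^m·y^m : Y ^ k ≈ Y ^ m · Y ^ m
    y^k≈y^m·y^m = begin
      Y ^ k           ≡⟨ ≡.cong (Y ^_) k≡q*m ⟩
      Y ^ (q ℕ.* m)   ≈⟨ y^[j*m]≈x^[j*k] q ⟩
      X ^ (q ℕ.* k)   ≈⟨ ^-periodic x^h≈e h∣q*k-2k ⟩
      X ^ (k ℕ.+ k)   ≈⟨ ^-+ X k k ⟩
      X ^ k · X ^ k   ≈⟨ ≈-sym (·-cong y^m≈x^k y^m≈x^k) ⟩
      Y ^ m · Y ^ m   ∎

  Twist⇔YRelations : Twist ⇔ YRelations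
  Twist⇔YRelations = mk⇔ Twist⇒YRelations YRelations⇒Twist

module TwistedGroupModel (m n ℓ : ℕ) where

  open TwistedGroup m n ℓ using (h; k; _≈_; YRelations)
  open Semidirect (+ h) (+ k) (+ m)

  ρ : Fin 3 → Elt
  ρ Fin.zero                     = ⟨ true  , + 0 , + 0 ⟩
  ρ (Fin.suc Fin.zero)           = ⟨ false , + 1 , + 0 ⟩
  ρ (Fin.suc (Fin.suc Fin.zero)) = ⟨ false , + 0 , + 1 ⟩

  open Evaluation (Gpres m n ℓ) group ρ

  eval-^ : ∀ w {a b} i → eval w ≡ ⟨ false , a , b ⟩ → eval (w ^ i) ≡ ⟨ false , + i * a , + i * b ⟩
  eval-^ w zero    eq = refl
  eval-^ w {a} {b} (suc i) eq rewrite eq | eval-^ w i eq =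
    ≡.cong₂ (λ a′ b′ → ⟨ false , a′ , b′ ⟩) (≡.sym (ℤP.suc-* (+ i) a)) (≡.sym (ℤP.suc-* (+ i) b))

  eval-rel : ∀ r → eval (Presentation.lhs (Gpres m n ℓ) r) ∼ eval (Presentation.rhs (Gpres m n ℓ) r)
  eval-rel Fin.zero = ∼-refl
  eval-rel (Fin.suc Fin.zero) =
    ∼-trans (∼-reflexive (eval-^ X h refl)) (mk∼ refl (+ 1 , + 0 , lin (+ h) (+ k) , neg (+ h) (+ m)))
    where
    lin : ∀ h k → h * + 1 - + 0 ≡ + 1 * h + + 0 * k
    lin = solve-∀
    neg : ∀ h m → h * + 0 - + 0 ≡ - (+ 0 * m)
    neg = solve-∀
  eval-rel (Fin.suc (Fin.suc Fin.zero)) =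
    ∼-trans (∼-reflexive (eval-^ Y m refl))
      (∼-trans (mk∼ refl (+ 0 , - + 1 , lin (+ h) (+ k) (+ m) , neg (+ k) (+ m)))
        (∼-sym (∼-reflexive (eval-^ X k refl))))
    where
    lin : ∀ h k m → m * + 0 - k * + 1 ≡ + 0 * h + (- + 1) * k
    lin = solve-∀
    neg : ∀ k m → m * + 1 - k * + 0 ≡ - ((- + 1) * m)
    neg = solve-∀
  eval-rel (Fin.suc (Fin.suc (Fin.suc Fin.zero))) = ∼-refl
  eval-rel (Fin.suc (Fin.suc (Fin.suc (Fin.suc Fin.zero)))) = ∼-refl
  eval-rel (Fin.suc (Fin.suc (Fin.suc (Fin.suc (Fin.suc Fin.zero))))) = ∼-refl

  YRelations⇒Λ : YRelations → Λ (+ 0) (+ h) × Λ (+ 0) (+ k - (+ m + + m))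
  YRelations⇒Λ (y^h≈e , y^k≈y^m·y^m) =
      Λ-resp (zero-a (+ h)) (one-b (+ h)) (_∼_.Λ-diff y^h)
    , Λ-resp (zero-a₂ (+ k) (+ m)) (one-b₂ (+ k) (+ m)) (_∼_.Λ-diff y^k)
    where
    y^h : ⟨ false , + h * + 0 , + h * + 1 ⟩ ∼ ε
    y^h = ∼-trans (∼-sym (∼-reflexive (eval-^ Y h refl))) (eval-cong eval-rel y^h≈e)
    y^k : ⟨ false , + k * + 0 , + k * + 1 ⟩ ∼ ⟨ false , + m * + 0 + + m * + 0 , + m * + 1 + + m * + 1 ⟩
    y^k = ∼-trans (∼-sym (∼-reflexive (eval-^ Y k refl)))
            (∼-trans (eval-cong eval-rel y^k≈y^m·y^m)
              (∼-reflexive (≡.cong₂ _∙_ (eval-^ Y m refl) (eval-^ Y m refl))))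
    zero-a : ∀ h → h * + 0 - + 0 ≡ + 0
    zero-a = solve-∀
    one-b : ∀ h → h * + 1 - + 0 ≡ h
    one-b = solve-∀
    zero-a₂ : ∀ k m → k * + 0 - (m * + 0 + m * + 0) ≡ + 0
    zero-a₂ = solve-∀
    one-b₂ : ∀ k m → k * + 1 - (m * + 1 + m * + 1) ≡ k - (m + m)
    one-b₂ = solve-∀

module Lattice (m h k : ℕ) .{{_ : ℕ.NonZero m}} where

  open Semidirect (+ h) (+ k) (+ m) using (Λ)
  open ≡.≡-Reasoning

  Λ[0,h]⇒m∣h,k : h ≢ 0 → Λ (+ 0) (+ h) → Σ ℕ λ p → Σ ℕ λ q → (h ≡ p ℕ.* m) × (k ≡ q ℕ.* m)
  Λ[0,h]⇒m∣h,k h≢0 (i , j , 0≡i*h+j*k , h≡-j*m) =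
    let p , h≡p*m , -j≡p = +-quotient {h} {m} { - j } (≡.trans h≡-j*m (ℤP.neg-distribˡ-* j (+ m)))
        q , k≡q*m , _    = +-quotient {k} {m} {i} (k≡i*m p h≡p*m -j≡p)
    in p , q , h≡p*m , k≡q*m
    where
    k≡i*m : ∀ p → h ≡ p ℕ.* m → - j ≡ + p → + k ≡ i * + m
    k≡i*m p h≡p*m -j≡p = ℤP.*-cancelˡ-≡ (+ p) (+ k) (i * + m) {{ℕ.≢-nonZero p≢0}} (begin
      + p * + k                         ≡⟨ ≡.cong (_* + k) -j≡p ⟨
      - j * + k                         ≡⟨ isolate i j (+ h) (+ k) ⟩
      i * + h - (i * + h + j * + k)     ≡⟨ ≡.cong (λ z → i * + h - z) 0≡i*h+j*k ⟨
      i * + h - + 0                     ≡⟨ ℤP.+-identityʳ (i * + h) ⟩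
      i * + h                           ≡⟨ ≡.cong (i *_) (≡.trans (≡.cong +_ h≡p*m) (ℤP.pos-* p m)) ⟩
      i * (+ p * + m)                   ≡⟨ swap i (+ p) (+ m) ⟩
      + p * (i * + m)                   ∎)
      where
      p≢0 : p ≢ 0
      p≢0 refl = h≢0 h≡p*m
      isolate : ∀ i j h k → - j * k ≡ i * h - (i * h + j * k)
      isolate = solve-∀
      swap : ∀ i p m → i * (p * m) ≡ p * (i * m)
      swap = solve-∀

  Λ[0,k-2m]⇒p∣q²-2q : ∀ {p q} → h ≡ p ℕ.* m → k ≡ q ℕ.* m → Λ (+ 0) (+ k - (+ m + + m)) →
                      Σ ℤ λ c → + q * + q - + 2 * + q ≡ c * + p
  Λ[0,k-2m]⇒p∣q²-2q {p} {q} h≡p*m k≡q*m (i , j , 0≡i*h+j*k , k-2m≡-j*m) =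
    i , ℤP.*-cancelʳ-≡ _ _ (+ m) (begin
      (Q * Q - + 2 * Q) * M             ≡⟨ expand Q M ⟩
      Q * (Q * M - (M + M))             ≡⟨ ≡.cong (λ z → Q * (z - (M + M))) K≡Q*M ⟨
      Q * (K - (M + M))                 ≡⟨ ≡.cong (Q *_) k-2m≡-j*m ⟩
      Q * - (j * M)                     ≡⟨ regroup Q j M ⟩
      - (j * (Q * M))                   ≡⟨ ≡.cong (λ z → - (j * z)) K≡Q*M ⟨
      - (j * K)                         ≡⟨ isolate i j H K ⟩
      i * H - (i * H + j * K)           ≡⟨ ≡.cong (λ z → i * H - z) 0≡i*h+j*k ⟨
      i * H - + 0                       ≡⟨ ℤP.+-identityʳ (i * H) ⟩
      i * H                             ≡⟨ ≡.cong (i *_) H≡P*M ⟩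
      i * (P * M)                       ≡⟨ ℤP.*-assoc i P M ⟨
      i * P * M                         ∎)
    where
    P Q M H K : ℤ
    P = + p
    Q = + q
    M = + m
    H = + h
    K = + k
    H≡P*M : H ≡ P * M
    H≡P*M = ≡.trans (≡.cong +_ h≡p*m) (ℤP.pos-* p m)
    K≡Q*M : K ≡ Q * M
    K≡Q*M = ≡.trans (≡.cong +_ k≡q*m) (ℤP.pos-* q m)
    expand : ∀ q m → (q * q - + 2 * q) * m ≡ q * (q * m - (m + m))
    expand = solve-∀
    regroup : ∀ q j m → q * - (j * m) ≡ - (j * (q * m))
    regroup = solve-∀
    isolate : ∀ i j h k → - (j * k) ≡ i * h - (i * h + j * k)
    isolate = solve-∀

  Λ⇒Factorisation : h ≢ 0 → Λ (+ 0) (+ h) → Λ (+ 0) (+ k - (+ m + + m)) → Factorisation m h k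
  Λ⇒Factorisation h≢0 Λ[0,h] Λ[0,k-2m] =
    let p , q , h≡p*m , k≡q*m = Λ[0,h]⇒m∣h,k h≢0 Λ[0,h]
        c , q²-2q≡c*p         = Λ[0,k-2m]⇒p∣q²-2q {p} {q} h≡p*m k≡q*m Λ[0,k-2m]
    in factorisation p q c h≡p*m k≡q*m q²-2q≡c*p

module Arithmetic (m n ℓ h k : ℕ) .{{_ : ℕ.NonZero m}} (n≡2h : n ≡ 2 ℕ.* h) (ℓ+m≡2k : ℓ ℕ.+ m ≡ 2 ℕ.* k) where

  open ≡.≡-Reasoning

  private
    M H K : ℤ
    M = + m
    H = + h
    K = + k

  D : ℤ
  D = + ℓ * + ℓ - + 2 * + m * + ℓ - + 3 * + m * + m

  Conditions : Set
  Conditions = (ℤG.gcd (+ n) (+ ℓ - + m) ≡ + (2 ℕ.* m)) × (+ (2 ℕ.* m ℕ.* n)) ℤD.∣ D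

  n≡2H : + n ≡ + 2 * H
  n≡2H = ≡.trans (≡.cong +_ n≡2h) (ℤP.pos-* 2 h)

  2M≡ : + (2 ℕ.* m) ≡ + 2 * M
  2M≡ = ℤP.pos-* 2 m

  ℓ≡2K-M : + ℓ ≡ + 2 * K - M
  ℓ≡2K-M = begin
    + ℓ               ≡⟨ cancel (+ ℓ) M ⟩
    (+ ℓ + M) - M     ≡⟨ ≡.cong (_- M) (ℤP.pos-+ ℓ m) ⟨
    + (ℓ ℕ.+ m) - M   ≡⟨ ≡.cong (λ z → + z - M) ℓ+m≡2k ⟩
    + (2 ℕ.* k) - M   ≡⟨ ≡.cong (_- M) (ℤP.pos-* 2 k) ⟩
    + 2 * K - M       ∎
    where
    cancel : ∀ a b → a ≡ (a + b) - b
    cancel = solve-∀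

  ℓ-m≡2K-2M : + ℓ - M ≡ + 2 * K - + 2 * M
  ℓ-m≡2K-2M = ≡.trans (≡.cong (_- M) ℓ≡2K-M) (regroup K M)
    where
    regroup : ∀ k m → (+ 2 * k - m) - m ≡ + 2 * k - + 2 * m
    regroup = solve-∀

  D≡4K[K-2M] : D ≡ + 4 * K * (K - + 2 * M)
  D≡4K[K-2M] = ≡.trans (≡.cong (λ l → l * l - + 2 * M * l - + 3 * M * M) ℓ≡2K-M) (factor K M)
    where
    factor : ∀ k m → (+ 2 * k - m) * (+ 2 * k - m) - + 2 * m * (+ 2 * k - m) - + 3 * m * m
                     ≡ + 4 * k * (k - + 2 * m)
    factor = solve-∀

  2mn≡4MH : + (2 ℕ.* m ℕ.* n) ≡ + 4 * M * H
  2mn≡4MH = begin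
    + (2 ℕ.* m ℕ.* n)      ≡⟨ ℤP.pos-* (2 ℕ.* m) n ⟩
    + (2 ℕ.* m) * + n      ≡⟨ ≡.cong₂ _*_ 2M≡ n≡2H ⟩
    (+ 2 * M) * (+ 2 * H)  ≡⟨ regroup M H ⟩
    + 4 * M * H            ∎
    where
    regroup : ∀ m h → (+ 2 * m) * (+ 2 * h) ≡ + 4 * m * h
    regroup = solve-∀

  D≡4M²[q²-2q] : ∀ {q} → k ≡ q ℕ.* m → D ≡ + 4 * M * M * (+ q * + q - + 2 * + q)
  D≡4M²[q²-2q] {q} k≡q*m = begin
    D                                  ≡⟨ D≡4K[K-2M] ⟩
    + 4 * K * (K - + 2 * M)            ≡⟨ ≡.cong (λ z → + 4 * z * (z - + 2 * M)) K≡Q*M ⟩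
    + 4 * (Q * M) * (Q * M - + 2 * M)  ≡⟨ factor Q M ⟩
    + 4 * M * M * (Q * Q - + 2 * Q)    ∎
    where
    Q = + q
    K≡Q*M : K ≡ Q * M
    K≡Q*M = ≡.trans (≡.cong +_ k≡q*m) (ℤP.pos-* q m)
    factor : ∀ q m → + 4 * (q * m) * (q * m - + 2 * m) ≡ + 4 * m * m * (q * q - + 2 * q)
    factor = solve-∀

  2mn≡4M²p : ∀ {p} → h ≡ p ℕ.* m → + (2 ℕ.* m ℕ.* n) ≡ + 4 * M * M * + p
  2mn≡4M²p {p} h≡p*m = begin
    + (2 ℕ.* m ℕ.* n)   ≡⟨ 2mn≡4MH ⟩
    + 4 * M * H         ≡⟨ ≡.cong (λ z → + 4 * M * z) (≡.trans (≡.cong +_ h≡p*m) (ℤP.pos-* p m)) ⟩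
    + 4 * M * (+ p * M) ≡⟨ regroup M (+ p) ⟩
    + 4 * M * M * + p   ∎
    where
    regroup : ∀ m p → + 4 * m * (p * m) ≡ + 4 * m * m * p
    regroup = solve-∀

  Factorisation⇒Conditions : Factorisation m h k → Conditions
  Factorisation⇒Conditions f = gcd≡2m , 2mn∣D
    where
    open Factorisation f
    P Q : ℤ
    P = + p
    Q = + q

    2m∣n : + (2 ℕ.* m) ℤS.∣ + n
    2m∣n = ℤS.divides P (begin
      + n                 ≡⟨ n≡2H ⟩
      + 2 * H             ≡⟨ ≡.cong (λ z → + 2 * z) +h≡p*m ⟩
      + 2 * (P * M)       ≡⟨ regroup P M ⟩
      P * (+ 2 * M)       ≡⟨ ≡.cong (P *_) 2M≡ ⟨
      P * + (2 ℕ.* m)     ∎)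
      where
      regroup : ∀ p m → + 2 * (p * m) ≡ p * (+ 2 * m)
      regroup = solve-∀

    2m∣ℓ-m : + (2 ℕ.* m) ℤS.∣ + ℓ - M
    2m∣ℓ-m = ℤS.divides (Q - + 1) (begin
      + ℓ - M                      ≡⟨ ℓ-m≡2K-2M ⟩
      + 2 * K - + 2 * M            ≡⟨ ≡.cong (λ z → + 2 * z - + 2 * M) +k≡q*m ⟩
      + 2 * (Q * M) - + 2 * M      ≡⟨ regroup Q M ⟩
      (Q - + 1) * (+ 2 * M)        ≡⟨ ≡.cong ((Q - + 1) *_) 2M≡ ⟨
      (Q - + 1) * + (2 ℕ.* m)      ∎)
      where
      regroup : ∀ q m → + 2 * (q * m) - + 2 * m ≡ (q - + 1) * (+ 2 * m)
      regroup = solve-∀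

    -- (q − 1)² − q (q − 2) = 1
    bezout : (- c) * + n + (Q - + 1) * (+ ℓ - M) ≡ + (2 ℕ.* m)
    bezout = begin
      (- c) * + n + (Q - + 1) * (+ ℓ - M)
        ≡⟨ ≡.cong₂ (λ a b → (- c) * a + (Q - + 1) * b) n≡2H ℓ-m≡2K-2M ⟩
      (- c) * (+ 2 * H) + (Q - + 1) * (+ 2 * K - + 2 * M)
        ≡⟨ ≡.cong₂ (λ a b → (- c) * (+ 2 * a) + (Q - + 1) * (+ 2 * b - + 2 * M)) +h≡p*m +k≡q*m ⟩
      (- c) * (+ 2 * (P * M)) + (Q - + 1) * (+ 2 * (Q * M) - + 2 * M)
        ≡⟨ expand Q M c P ⟩
      + 2 * M + + 2 * M * ((Q * Q - + 2 * Q) - c * P)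
        ≡⟨ ≡.cong (λ z → + 2 * M + + 2 * M * (z - c * P)) q²-2q≡c*p ⟩
      + 2 * M + + 2 * M * (c * P - c * P)
        ≡⟨ collapse M (c * P) ⟩
      + 2 * M
        ≡⟨ 2M≡ ⟨
      + (2 ℕ.* m) ∎
      where
      expand : ∀ q m c p → (- c) * (+ 2 * (p * m)) + (q - + 1) * (+ 2 * (q * m) - + 2 * m)
                           ≡ + 2 * m + + 2 * m * ((q * q - + 2 * q) - c * p)
      expand = solve-∀
      collapse : ∀ m a → + 2 * m + + 2 * m * (a - a) ≡ + 2 * m
      collapse = solve-∀

    gcd≡2m : ℤG.gcd (+ n) (+ ℓ - + m) ≡ + (2 ℕ.* m)
    gcd≡2m = gcd-bezout (- c) (Q - + 1) 2m∣n 2m∣ℓ-m bezout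

    2mn∣D : + (2 ℕ.* m ℕ.* n) ℤD.∣ D
    2mn∣D = ℤS.∣⇒∣ᵤ (ℤS.divides c (begin
      D                                  ≡⟨ D≡4M²[q²-2q] {q} k≡q*m ⟩
      + 4 * M * M * (Q * Q - + 2 * Q)    ≡⟨ ≡.cong (λ z → + 4 * M * M * z) q²-2q≡c*p ⟩
      + 4 * M * M * (c * P)              ≡⟨ regroup (+ 4 * M * M) c P ⟩
      c * (+ 4 * M * M * P)              ≡⟨ ≡.cong (c *_) (2mn≡4M²p {p} h≡p*m) ⟨
      c * + (2 ℕ.* m ℕ.* n)              ∎))
      where
      regroup : ∀ a c p → a * (c * p) ≡ c * (a * p)
      regroup = solve-∀

  Conditions⇒Factorisation : Conditions → Factorisation m h k
  Conditions⇒Factorisation (gcd≡2m , 2mn∣D) = factorisation p q c h≡p*m k≡q*m q²-2q≡c*p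
    where
    2m∣n : 2 ℕ.* m ℕD.∣ 2 ℕ.* h
    2m∣n = ≡.subst₂ ℕD._∣_ (ℤP.+-injective gcd≡2m) n≡2h (ℤG.gcd[i,j]∣i (+ n) (+ ℓ - + m))

    2m∣ℓ-m : + (2 ℕ.* m) ℤS.∣ + ℓ - M
    2m∣ℓ-m = ℤS.∣ᵤ⇒∣ (≡.subst (ℤD._∣ (+ ℓ - M)) gcd≡2m (ℤG.gcd[i,j]∣j (+ n) (+ ℓ - + m)))

    ℓ-m+2m≡2k : + ℓ - M + + (2 ℕ.* m) ≡ + (2 ℕ.* k)
    ℓ-m+2m≡2k = begin
      + ℓ - M + + (2 ℕ.* m)          ≡⟨ ≡.cong₂ _+_ ℓ-m≡2K-2M 2M≡ ⟩
      + 2 * K - + 2 * M + + 2 * M    ≡⟨ cancel K M ⟩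
      + 2 * K                        ≡⟨ ℤP.pos-* 2 k ⟨
      + (2 ℕ.* k)                    ∎
      where
      cancel : ∀ k m → + 2 * k - + 2 * m + + 2 * m ≡ + 2 * k
      cancel = solve-∀

    2m∣2k : 2 ℕ.* m ℕD.∣ 2 ℕ.* k
    2m∣2k = ℤS.∣⇒∣ᵤ (≡.subst (+ (2 ℕ.* m) ℤS.∣_) ℓ-m+2m≡2k (ℤS.∣m∣n⇒∣m+n 2m∣ℓ-m ℤS.∣-refl))

    m∣h : m ℕD.∣ h
    m∣h = ℕD.*-cancelˡ-∣ 2 2m∣n
    m∣k : m ℕD.∣ k
    m∣k = ℕD.*-cancelˡ-∣ 2 2m∣2k

    p q : ℕ
    p = ℕD.quotient m∣h
    q = ℕD.quotient m∣k
    h≡p*m : h ≡ p ℕ.* m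
    h≡p*m = ℕD.m∣n⇒n≡quotient*m m∣h
    k≡q*m : k ≡ q ℕ.* m
    k≡q*m = ℕD.m∣n⇒n≡quotient*m m∣k

    open ℤS._∣_ (ℤS.∣ᵤ⇒∣ {+ (2 ℕ.* m ℕ.* n)} {D} 2mn∣D) renaming (quotient to c; equality to D≡c*2mn)

    q²-2q≡c*p : + q * + q - + 2 * + q ≡ c * + p
    q²-2q≡c*p = ℤP.*-cancelˡ-≡ (+ 4 * M * M) _ _ {{ℤP.i*j≢0 (+ 4 * M) M {{ℤP.i*j≢0 (+ 4) M}}}} (begin
      + 4 * M * M * (+ q * + q - + 2 * + q) ≡⟨ D≡4M²[q²-2q] {q} k≡q*m ⟨
      D                                     ≡⟨ D≡c*2mn ⟩
      c * + (2 ℕ.* m ℕ.* n)                 ≡⟨ ≡.cong (c *_) (2mn≡4M²p {p} h≡p*m) ⟩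
      c * (+ 4 * M * M * + p)               ≡⟨ regroup c (+ 4 * M * M) (+ p) ⟩
      + 4 * M * M * (c * + p)               ∎)
      where
      regroup : ∀ c a p → c * (a * p) ≡ a * (c * p)
      regroup = solve-∀

  Factorisation⇔Conditions : Factorisation m h k ⇔ Conditions
  Factorisation⇔Conditions = mk⇔ Factorisation⇒Conditions Conditions⇒Factorisation

YRelations⇔Factorisation : ∀ m n ℓ .{{_ : ℕ.NonZero m}} → n ℕ./ 2 ≢ 0 →
  TwistedGroup.YRelations m n ℓ ⇔ Factorisation m (n ℕ./ 2) ((ℓ ℕ.+ m) ℕ./ 2)
YRelations⇔Factorisation m n ℓ h≢0 = mk⇔
  (λ rels → let Λ[0,h] , Λ[0,k-2m] = TwistedGroupModel.YRelations⇒Λ m n ℓ rels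
            in Lattice.Λ⇒Factorisation m _ _ h≢0 Λ[0,h] Λ[0,k-2m])
  (TwistedGroup.Factorisation⇒YRelations m n ℓ)

lemma4p2 : (m n ℓ : ℕ) → 1 ≤ m → 4 ≤ n → 2 ℕD.∣ n → ℓ < n → 2 ℕD.∣ (ℓ ℕ.+ m) →
    (Σ (Group.Carrier (G m n ℓ) → Group.Carrier (G m n ℓ)) λ φ →
        GroupMorphisms.IsGroupIsomorphism (Group.rawGroup (G m n ℓ)) (Group.rawGroup (G m n ℓ)) φ
      × Group._≈_ (G m n ℓ) (φ (T · X)) (T · X)
      × Group._≈_ (G m n ℓ) (φ T) (T · Y)
      × Group._≈_ (G m n ℓ) (φ (T · Y)) T)
    ⇔ ((ℤG.gcd (+ n) (+ ℓ - + m) ≡ + (2 ℕ.* m))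
      × (+ (2 ℕ.* m ℕ.* n)) ℤD.∣ (+ ℓ * + ℓ - + 2 * + m * + ℓ - + 3 * + m * + m))
lemma4p2 m@(suc _) n ℓ _ 4≤n 2∣n _ 2∣ℓ+m =
      Arithmetic.Factorisation⇔Conditions m n ℓ _ _ n≡2h ℓ+m≡2k
  ⇔-∘ (YRelations⇔Factorisation m n ℓ h≢0
  ⇔-∘ TwistedGroup.Twist⇔YRelations m n ℓ)
  where
  n≡2h : n ≡ 2 ℕ.* (n ℕ./ 2)
  n≡2h = ≡.sym (ℕDM.m*[n/m]≡n 2∣n)
  ℓ+m≡2k : ℓ ℕ.+ m ≡ 2 ℕ.* ((ℓ ℕ.+ m) ℕ./ 2)
  ℓ+m≡2k = ≡.sym (ℕDM.m*[n/m]≡n 2∣ℓ+m)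
  h≢0 : n ℕ./ 2 ≢ 0
  h≢0 = ℕP.n>0⇒n≢0 (ℕDM.m≥n⇒m/n>0 (ℕP.≤-trans (ℕP.m≤n+m 2 2) 4≤n))
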